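{- Let $G$ be a graph (loops and multiple edges allowed) and let $\mathcal W$ be a set of closed walks in $G$. Then there exists a signature $\sigma: E(G)\to\{+,-\}$ such that $\mathcal W$ is exactly the set of negative closed walks of the signed graph $(G,\sigma)$ if and only if $\mathcal W$ is closed under rotation and satisfies the exclusive 3-walk property.
   Context: A signed graph $(G,\sigma)$ is a graph $G$ together with a signature $\sigma:E(G)\to\{+,-\}$. A closed walk in $(G,\sigma)$ is negative if it traverses an odd number of edges marked $-$ (counted with multiplicity). A rotation of a closed walk $W$ is a closed walk with the same cyclic sequence of edges as $W$ but starting at a different vertex of $W$; a set of closed walks is closed under rotation if it contains every rotation of each of its members. For walks $W_1$ (from $x$ to $y$) and $W_2$ (from $x$ to $y$), $W_2^{ -1}$ denotes the reverse walk and $W_1W_2^{ -1}$ the concatenation, a closed walk at $x$; trivial walks (a single vertex, no edges) are closed walks. For a set $\mathcal W$ of closed walks define $\sigma_{\mathcal W}(W)=-$ if $W\in\mathcal W$ and $\sigma_{\mathcal W}(W)=+$ otherwise. $\mathcal W$ satisfies the exclusive 3-walk property if for every two vertices $x,y$ and every three $xy$-walks $W_1,W_2,W_3$ we have $\sigma_{\mathcal W}(W_1W_2^{ -1})\cdot\sigma_{\mathcal W}(W_1W_3^{ -1})\cdot\sigma_{\mathcal W}(W_2W_3^{ -1})=+$, i.e. an even number of these three closed walks lie in $\mathcal W$. -}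

module Defs where

open import Data.Nat using (ℕ; zero; suc; _+_; _%_)
open import Data.Fin using (Fin; _≟_)
open import Data.Bool using (Bool; true; false; _∧_; _∨_; T; if_then_else_)
open import Data.Bool.Properties using (∨-comm)
open import Data.Product using (Σ; _×_; _,_; ∃; ∃-syntax)
open import Relation.Nullary.Decidable using (⌊_⌋)
open import Relation.Binary.PropositionalEquality using (_≡_; subst)
open import Function.Bundles using (_⇔_)

-- A finite graph with loops and multiple edges allowed:
-- vertices Fin nV, edges Fin nE, each edge has an (unordered) pair of ends.
record Graph : Set where
  field
    nV : ℕ
    nE : ℕ
    ends : Fin nE → Fin nV × Fin nV

module _ (G : Graph) where
  open Graph G

  V : Set
  V = Fin nV

  E : Set
  E = Fin nE

  -- edge e joins u and v (in either order); Bool-valued so that the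
  -- incidence witness T (joins e u v) is proof-irrelevant
  joins : E → V → V → Bool
  joins e u v with ends e
  ... | a , b = (⌊ a ≟ u ⌋ ∧ ⌊ b ≟ v ⌋) ∨ (⌊ a ≟ v ⌋ ∧ ⌊ b ≟ u ⌋)

  joins-sym : ∀ e u v → T (joins e u v) → T (joins e v u)
  joins-sym e u v p with ends e
  ... | a , b = subst T (∨-comm (⌊ a ≟ u ⌋ ∧ ⌊ b ≟ v ⌋) (⌊ a ≟ v ⌋ ∧ ⌊ b ≟ u ⌋)) p

  data Walk : V → V → Set where
    []   : ∀ {x} → Walk x x
    step : ∀ {x} (e : E) {y z} → T (joins e x y) → Walk y z → Walk x z

  _++_ : ∀ {x y z} → Walk x y → Walk y z → Walk x z
  [] ++ q = q
  step e p w ++ q = step e p (w ++ q)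

  reverse : ∀ {x y} → Walk x y → Walk y x
  reverse [] = []
  reverse (step {x} e {y} p w) = reverse w ++ step e (joins-sym e x y p) []

  ClosedWalk : Set
  ClosedWalk = Σ V (λ x → Walk x x)

  _·_⁻¹ : ∀ {x y} → Walk x y → Walk x y → ClosedWalk
  _·_⁻¹ {x} w₁ w₂ = x , (w₁ ++ reverse w₂)

data Sign : Set where
  pos neg : Sign

_*ˢ_ : Sign → Sign → Sign
pos *ˢ s = s
neg *ˢ pos = neg
neg *ˢ neg = pos

module _ {G : Graph} where
  open Graph G

  Signature : Set
  Signature = E G → Sign

  negCount : Signature → ∀ {x y} → Walk G x y → ℕ
  negCount σ [] = 0
  negCount σ (step e p w) with σ e
  ... | pos = negCount σ w
  ... | neg = suc (negCount σ w)

  Negative : Signature → ClosedWalk G → Set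
  Negative σ (x , w) = negCount σ w % 2 ≡ 1

  WalkSet : Set
  WalkSet = ClosedWalk G → Bool

  σ[_] : WalkSet → ClosedWalk G → Sign
  σ[ 𝒲 ] c = if 𝒲 c then neg else pos

  ClosedUnderRotation : WalkSet → Set
  ClosedUnderRotation 𝒲 =
    ∀ {x y} (P : Walk G x y) (Q : Walk G y x) →
    𝒲 (x , _++_ G P Q) ≡ true → 𝒲 (y , _++_ G Q P) ≡ true

  Exclusive3Walk : WalkSet → Set
  Exclusive3Walk 𝒲 =
    ∀ {x y} (W₁ W₂ W₃ : Walk G x y) →
    (σ[ 𝒲 ] (_·_⁻¹ G W₁ W₂) *ˢ σ[ 𝒲 ] (_·_⁻¹ G W₁ W₃)) *ˢ σ[ 𝒲 ] (_·_⁻¹ G W₂ W₃) ≡ pos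

  IsNegativeWalkSetOf : Signature → WalkSet → Set
  IsNegativeWalkSetOf σ 𝒲 = ∀ (c : ClosedWalk G) → (𝒲 c ≡ true) ⇔ Negative σ c

-- Necessity: the sign of a closed walk is multiplicative and invariant under
-- reversal and rotation, so σ(W₁W₂⁻¹) = σ(W₁)σ(W₂) and the three signs multiply to +.
--
-- Sufficiency: write δ(W₁, W₂) for σ_𝒲(W₁W₂⁻¹). The exclusive 3-walk property says
-- exactly that δ is a cocycle, δ(W₁, W₃) = δ(W₁, W₂) δ(W₂, W₃). Merging components
-- edge by edge, choose a root r(v) and a walk Pᵥ from r(v) to v in every component, and
-- give an edge e = uw the sign δ(Pᵤe, P_w). Induction along a walk W from u to v, one
-- cocycle step per edge, gives δ(PᵤW, Pᵥ) = σ(W); for a closed walk at x, rotation and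
-- the cancellation of Pₓ⁻¹Pₓ turn δ(PₓW, Pₓ) into σ_𝒲(W).
module Submission where

open import Defs
open import Data.Product using (Σ; _×_; ∃-syntax; _,_; proj₁; proj₂)
open import Function.Bundles using (_⇔_; mk⇔; module Equivalence)

open import Data.Nat using (ℕ; zero; suc; _+_; _%_)
open import Data.Fin using (_≟_)
open import Data.Bool using (true; false; T)
open import Data.Bool.Properties using (T-irrelevant)
open import Data.Sum using (_⊎_; inj₁; inj₂)
open import Data.Empty using (⊥-elim)
open import Data.Unit using (tt)
open import Data.List using (List; []; _∷_; allFin)
open import Data.List.Relation.Unary.Any using (here; there)
open import Data.List.Membership.Propositional using (_∈_)
open import Data.List.Membership.Propositional.Properties using (∈-allFin)
open import Relation.Nullary using (¬_; yes; no; contradiction)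
open import Relation.Binary.PropositionalEquality
open import Axiom.UniquenessOfIdentityProofs using (module Decidable⇒UIP)

open Equivalence using (to; from)

signOf : ℕ → Sign
signOf zero    = pos
signOf (suc n) = neg *ˢ signOf n

*ˢ-identityʳ : ∀ a → a *ˢ pos ≡ a
*ˢ-identityʳ pos = refl
*ˢ-identityʳ neg = refl

*ˢ-comm : ∀ a b → a *ˢ b ≡ b *ˢ a
*ˢ-comm pos pos = refl
*ˢ-comm pos neg = refl
*ˢ-comm neg pos = refl
*ˢ-comm neg neg = refl

*ˢ-assoc : ∀ a b c → (a *ˢ b) *ˢ c ≡ a *ˢ (b *ˢ c)
*ˢ-assoc pos b   c   = refl
*ˢ-assoc neg pos c   = refl
*ˢ-assoc neg neg pos = refl
*ˢ-assoc neg neg neg = refl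

*ˢ-self : ∀ a → a *ˢ a ≡ pos
*ˢ-self pos = refl
*ˢ-self neg = refl

neg-involutive : ∀ a → neg *ˢ (neg *ˢ a) ≡ a
neg-involutive pos = refl
neg-involutive neg = refl

≢neg⇒≡pos : ∀ a → ¬ a ≡ neg → a ≡ pos
≢neg⇒≡pos pos _    = refl
≢neg⇒≡pos neg a≢neg = contradiction refl a≢neg

ab≡pos⇒a≡b : ∀ a b → a *ˢ b ≡ pos → a ≡ b
ab≡pos⇒a≡b pos pos _ = refl
ab≡pos⇒a≡b neg neg _ = refl
ab≡pos⇒a≡b pos neg ()
ab≡pos⇒a≡b neg pos ()

[ab]c≡pos⇒b≡ac : ∀ a b c → (a *ˢ b) *ˢ c ≡ pos → b ≡ a *ˢ c
[ab]c≡pos⇒b≡ac pos pos pos _ = refl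
[ab]c≡pos⇒b≡ac pos neg neg _ = refl
[ab]c≡pos⇒b≡ac neg pos neg _ = refl
[ab]c≡pos⇒b≡ac neg neg pos _ = refl
[ab]c≡pos⇒b≡ac pos pos neg ()
[ab]c≡pos⇒b≡ac pos neg pos ()
[ab]c≡pos⇒b≡ac neg pos pos ()
[ab]c≡pos⇒b≡ac neg neg neg ()

[ab][ac][bc]≡pos : ∀ a b c → ((a *ˢ b) *ˢ (a *ˢ c)) *ˢ (b *ˢ c) ≡ pos
[ab][ac][bc]≡pos pos pos pos = refl
[ab][ac][bc]≡pos pos pos neg = refl
[ab][ac][bc]≡pos pos neg pos = refl
[ab][ac][bc]≡pos pos neg neg = refl
[ab][ac][bc]≡pos neg pos pos = refl
[ab][ac][bc]≡pos neg pos neg = refl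
[ab][ac][bc]≡pos neg neg pos = refl
[ab][ac][bc]≡pos neg neg neg = refl

signOf-+ : ∀ m n → signOf (m + n) ≡ signOf m *ˢ signOf n
signOf-+ zero    n = refl
signOf-+ (suc m) n = trans (cong (neg *ˢ_) (signOf-+ m n)) (sym (*ˢ-assoc neg (signOf m) (signOf n)))

signOf≡neg⇔odd : ∀ n → (signOf n ≡ neg) ⇔ (n % 2 ≡ 1)
signOf≡neg⇔odd zero          = mk⇔ (λ ()) (λ ())
signOf≡neg⇔odd (suc zero)    = mk⇔ (λ _ → refl) (λ _ → refl)
signOf≡neg⇔odd (suc (suc n)) =
  mk⇔ (λ h → to (signOf≡neg⇔odd n) (trans (sym (neg-involutive (signOf n))) h))
      (λ h → trans (neg-involutive (signOf n)) (from (signOf≡neg⇔odd n) h))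

module _ {G : Graph} where

  infixr 5 _⊕_

  _⊕_ : ∀ {x y z} → Walk G x y → Walk G y z → Walk G x z
  _⊕_ = _++_ G

  rev : ∀ {x y} → Walk G x y → Walk G y x
  rev = reverse G

  edge : ∀ e {u w} → T (joins G e u w) → Walk G u w
  edge e p = step e p []

  ⊕-identityʳ : ∀ {x y} (p : Walk G x y) → p ⊕ [] ≡ p
  ⊕-identityʳ []           = refl
  ⊕-identityʳ (step e a p) = cong (step e a) (⊕-identityʳ p)

  ⊕-assoc : ∀ {x y z t} (p : Walk G x y) (q : Walk G y z) (r : Walk G z t) →
            (p ⊕ q) ⊕ r ≡ p ⊕ (q ⊕ r)
  ⊕-assoc []           q r = refl
  ⊕-assoc (step e a p) q r = cong (step e a) (⊕-assoc p q r)

  rev-⊕ : ∀ {x y z} (p : Walk G x y) (q : Walk G y z) → rev (p ⊕ q) ≡ rev q ⊕ rev p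
  rev-⊕ []           q = sym (⊕-identityʳ (rev q))
  rev-⊕ (step e a p) q =
    trans (cong (_⊕ edge e _) (rev-⊕ p q)) (⊕-assoc (rev q) (rev p) (edge e _))

  rev-edge : ∀ e {u w} (p : T (joins G e u w)) (q : T (joins G e w u)) → rev (edge e p) ≡ edge e q
  rev-edge e p q = cong (edge e) (T-irrelevant _ q)

  rev-involutive : ∀ {x y} (p : Walk G x y) → rev (rev p) ≡ p
  rev-involutive []                  = refl
  rev-involutive (step {x} e {y} a p) = begin
    rev (rev p ⊕ edge e _)          ≡⟨ rev-⊕ (rev p) (edge e _) ⟩
    rev (edge e _) ⊕ rev (rev p)    ≡⟨ cong₂ _⊕_ (rev-edge e _ a) (rev-involutive p) ⟩
    step e a p                      ∎
    where open ≡-Reasoning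

  rev-rev-⊕ : ∀ {x y z} (p : Walk G y x) (q : Walk G y z) → rev (rev p ⊕ q) ≡ rev q ⊕ p
  rev-rev-⊕ p q = trans (rev-⊕ (rev p) q) (cong (rev q ⊕_) (rev-involutive p))

  rev-⊕-rev : ∀ {x y z} (p : Walk G x y) (q : Walk G z y) → rev (p ⊕ rev q) ≡ q ⊕ rev p
  rev-⊕-rev p q = trans (rev-⊕ p (rev q)) (cong (_⊕ rev p) (rev-involutive q))

  ·⁻¹-shift : ∀ {x y z} (A : Walk G x y) (W : Walk G y z) (B : Walk G x z) →
              _·_⁻¹ G (A ⊕ W) B ≡ _·_⁻¹ G A (B ⊕ rev W)
  ·⁻¹-shift A W B = cong (_ ,_) (begin
    (A ⊕ W) ⊕ rev B           ≡⟨ ⊕-assoc A W (rev B) ⟩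
    A ⊕ (W ⊕ rev B)           ≡⟨ cong (A ⊕_) (sym (rev-⊕-rev B W)) ⟩
    A ⊕ rev (B ⊕ rev W)       ∎)
    where open ≡-Reasoning

module Incidence (G : Graph) where
  open Graph G using (ends)

  end₁ end₂ : E G → V G
  end₁ e = proj₁ (ends e)
  end₂ e = proj₂ (ends e)

  joins-ends : ∀ e → T (joins G e (end₁ e) (end₂ e))
  joins-ends e with ends e
  ... | a , b with a ≟ a | b ≟ b
  ... | yes _ | yes _   = tt
  ... | no a≢a | _      = ⊥-elim (a≢a refl)
  ... | yes _ | no b≢b  = ⊥-elim (b≢b refl)

  joins⇒ends : ∀ e {u w} → T (joins G e u w) →
               (end₁ e ≡ u × end₂ e ≡ w) ⊎ (end₁ e ≡ w × end₂ e ≡ u)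
  joins⇒ends e {u} {w} p with ends e
  ... | a , b with a ≟ u | b ≟ w | a ≟ w | b ≟ u
  ... | yes a≡u | yes b≡w | _       | _       = inj₁ (a≡u , b≡w)
  ... | _       | _       | yes a≡w | yes b≡u = inj₂ (a≡w , b≡u)
  ... | no _    | _       | no _    | _       = ⊥-elim p
  ... | no _    | _       | yes _   | no _    = ⊥-elim p
  ... | yes _   | no _    | no _    | _       = ⊥-elim p
  ... | yes _   | no _    | yes _   | no _    = ⊥-elim p

module _ {G : Graph} (σ : Signature {G}) where

  walkSign : ∀ {x y} → Walk G x y → Sign
  walkSign w = signOf (negCount σ w)

  walkSign-step : ∀ e {x y z} (a : T (joins G e x y)) (w : Walk G y z) →
                  walkSign (step e a w) ≡ σ e *ˢ walkSign w
  walkSign-step e a w with σ e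
  ... | pos = refl
  ... | neg = refl

  negCount-⊕ : ∀ {x y z} (p : Walk G x y) (q : Walk G y z) →
               negCount σ (p ⊕ q) ≡ negCount σ p + negCount σ q
  negCount-⊕ []           q = refl
  negCount-⊕ (step e a p) q with σ e
  ... | pos = negCount-⊕ p q
  ... | neg = cong suc (negCount-⊕ p q)

  walkSign-⊕ : ∀ {x y z} (p : Walk G x y) (q : Walk G y z) →
               walkSign (p ⊕ q) ≡ walkSign p *ˢ walkSign q
  walkSign-⊕ p q = trans (cong signOf (negCount-⊕ p q)) (signOf-+ (negCount σ p) (negCount σ q))

  walkSign-rev : ∀ {x y} (p : Walk G x y) → walkSign (rev p) ≡ walkSign p
  walkSign-rev []                  = refl
  walkSign-rev (step {x} e {y} a p) = begin
    walkSign (rev p ⊕ edge e a′)              ≡⟨ walkSign-⊕ (rev p) (edge e a′) ⟩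
    walkSign (rev p) *ˢ walkSign (edge e a′)  ≡⟨ cong₂ _*ˢ_ (walkSign-rev p) (walkSign-step e a′ []) ⟩
    walkSign p *ˢ (σ e *ˢ pos)                ≡⟨ cong (walkSign p *ˢ_) (*ˢ-identityʳ (σ e)) ⟩
    walkSign p *ˢ σ e                         ≡⟨ *ˢ-comm (walkSign p) (σ e) ⟩
    σ e *ˢ walkSign p                         ≡⟨ walkSign-step e a p ⟨
    walkSign (step e a p)                     ∎
    where
      open ≡-Reasoning
      a′ = joins-sym G e x y a

  negative⇔walkSign≡neg : ∀ {x} (w : Walk G x x) → Negative σ (x , w) ⇔ (walkSign w ≡ neg)
  negative⇔walkSign≡neg w = mk⇔ (from (signOf≡neg⇔odd (negCount σ w)))
                                (to (signOf≡neg⇔odd (negCount σ w)))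

RotationInvariant : {G : Graph} → (ClosedWalk G → Sign) → Set
RotationInvariant {G} s = ∀ {x y} (P : Walk G x y) (Q : Walk G y x) → s (x , P ⊕ Q) ≡ s (y , Q ⊕ P)

module _ {G : Graph} {𝒲 : WalkSet {G}} where

  ∈⇔σ[]≡neg : ∀ c → (𝒲 c ≡ true) ⇔ (σ[ 𝒲 ] c ≡ neg)
  ∈⇔σ[]≡neg c with 𝒲 c
  ... | true  = mk⇔ (λ _ → refl) (λ _ → refl)
  ... | false = mk⇔ (λ ()) (λ ())

  isNegativeWalkSetOf⇔ : ∀ σ →
    IsNegativeWalkSetOf σ 𝒲 ⇔ (∀ {x} (w : Walk G x x) → σ[ 𝒲 ] (x , w) ≡ walkSign σ w)
  isNegativeWalkSetOf⇔ σ = mk⇔ sign-agrees negative-iff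
    where
      sign-agrees : IsNegativeWalkSetOf σ 𝒲 → ∀ {x} (w : Walk G x x) → σ[ 𝒲 ] (x , w) ≡ walkSign σ w
      sign-agrees h {x} w with 𝒲 (x , w) in w∈?
      ... | true  = sym (to (negative⇔walkSign≡neg σ w) (to (h (x , w)) w∈?))
      ... | false = sym (≢neg⇒≡pos (walkSign σ w) λ w-neg →
        contradiction (trans (sym (from (h (x , w)) (from (negative⇔walkSign≡neg σ w) w-neg))) w∈?) λ ())

      negative-iff : (∀ {x} (w : Walk G x x) → σ[ 𝒲 ] (x , w) ≡ walkSign σ w) → IsNegativeWalkSetOf σ 𝒲
      negative-iff agrees (x , w) = mk⇔
        (λ w∈ → from (negative⇔walkSign≡neg σ w)
                  (trans (sym (agrees w)) (to (∈⇔σ[]≡neg (x , w)) w∈)))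
        (λ neg-w → from (∈⇔σ[]≡neg (x , w))
                     (trans (agrees w) (to (negative⇔walkSign≡neg σ w) neg-w)))

  closedUnderRotation⇔ : ClosedUnderRotation 𝒲 ⇔ RotationInvariant σ[ 𝒲 ]
  closedUnderRotation⇔ = mk⇔ invariant closed
    where
      invariant : ClosedUnderRotation 𝒲 → RotationInvariant σ[ 𝒲 ]
      invariant rotate {x} {y} P Q with 𝒲 (x , P ⊕ Q) in PQ∈? | 𝒲 (y , Q ⊕ P) in QP∈?
      ... | true  | true  = refl
      ... | false | false = refl
      ... | true  | false = contradiction (trans (sym (rotate P Q PQ∈?)) QP∈?) λ ()
      ... | false | true  = contradiction (trans (sym (rotate Q P QP∈?)) PQ∈?) λ ()

      closed : RotationInvariant σ[ 𝒲 ] → ClosedUnderRotation 𝒲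
      closed invariant {x} {y} P Q PQ∈ = from (∈⇔σ[]≡neg (y , Q ⊕ P))
        (trans (sym (invariant P Q)) (to (∈⇔σ[]≡neg (x , P ⊕ Q)) PQ∈))

module _ {G : Graph} {𝒲 : WalkSet {G}} {σ : Signature {G}} (𝒲-negative : IsNegativeWalkSetOf σ 𝒲) where

  private
    σ[𝒲]≡walkSign : ∀ {x} (w : Walk G x x) → σ[ 𝒲 ] (x , w) ≡ walkSign σ w
    σ[𝒲]≡walkSign = to (isNegativeWalkSetOf⇔ σ) 𝒲-negative

    σ[𝒲]-·⁻¹ : ∀ {x y} (W₁ W₂ : Walk G x y) → σ[ 𝒲 ] (_·_⁻¹ G W₁ W₂) ≡ walkSign σ W₁ *ˢ walkSign σ W₂
    σ[𝒲]-·⁻¹ W₁ W₂ = begin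
      σ[ 𝒲 ] (_ , W₁ ⊕ rev W₂)             ≡⟨ σ[𝒲]≡walkSign (W₁ ⊕ rev W₂) ⟩
      walkSign σ (W₁ ⊕ rev W₂)              ≡⟨ walkSign-⊕ σ W₁ (rev W₂) ⟩
      walkSign σ W₁ *ˢ walkSign σ (rev W₂)  ≡⟨ cong (walkSign σ W₁ *ˢ_) (walkSign-rev σ W₂) ⟩
      walkSign σ W₁ *ˢ walkSign σ W₂        ∎
      where open ≡-Reasoning

  negativeWalkSet-closedUnderRotation : ClosedUnderRotation 𝒲
  negativeWalkSet-closedUnderRotation = from (closedUnderRotation⇔ {𝒲 = 𝒲}) λ {x} {y} P Q → begin
    σ[ 𝒲 ] (x , P ⊕ Q)                   ≡⟨ σ[𝒲]≡walkSign (P ⊕ Q) ⟩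
    walkSign σ (P ⊕ Q)                    ≡⟨ walkSign-⊕ σ P Q ⟩
    walkSign σ P *ˢ walkSign σ Q          ≡⟨ *ˢ-comm (walkSign σ P) (walkSign σ Q) ⟩
    walkSign σ Q *ˢ walkSign σ P          ≡⟨ walkSign-⊕ σ Q P ⟨
    walkSign σ (Q ⊕ P)                    ≡⟨ σ[𝒲]≡walkSign (Q ⊕ P) ⟨
    σ[ 𝒲 ] (y , Q ⊕ P)                   ∎
    where open ≡-Reasoning

  negativeWalkSet-exclusive3Walk : Exclusive3Walk 𝒲
  negativeWalkSet-exclusive3Walk W₁ W₂ W₃
    rewrite σ[𝒲]-·⁻¹ W₁ W₂ | σ[𝒲]-·⁻¹ W₁ W₃ | σ[𝒲]-·⁻¹ W₂ W₃ =
    [ab][ac][bc]≡pos (walkSign σ W₁) (walkSign σ W₂) (walkSign σ W₃)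

record Rooting (G : Graph) : Set where
  field
    root       : V G → V G
    path       : ∀ v → Walk G (root v) v
    root-joins : ∀ e {u w} → T (joins G e u w) → root u ≡ root w

module UnionFind {G : Graph} where
  open Incidence G

  RootedWalks : Set
  RootedWalks = (v : V G) → Σ (V G) (λ r → Walk G r v)

  rootOf : RootedWalks → V G → V G
  rootOf F v = proj₁ (F v)

  walkOf : (F : RootedWalks) (v : V G) → Walk G (rootOf F v) v
  walkOf F v = proj₂ (F v)

  redirect : V G → V G → V G → V G
  redirect old new t with t ≟ old
  ... | yes _ = new
  ... | no  _ = t

  redirect-old : ∀ old new → redirect old new old ≡ new
  redirect-old old new with old ≟ old
  ... | yes _    = refl
  ... | no o≢o   = ⊥-elim (o≢o refl)

  redirect-new : ∀ old new → redirect old new new ≡ new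
  redirect-new old new with new ≟ old
  ... | yes _ = refl
  ... | no  _ = refl

  merge : E G → RootedWalks → RootedWalks
  merge e F v with rootOf F v ≟ rootOf F (end₂ e)
  ... | yes same = rootOf F (end₁ e)
                 , (walkOf F (end₁ e) ⊕ edge e (joins-ends e) ⊕ rev (walkOf F (end₂ e)))
                   ⊕ subst (λ r → Walk G r v) same (walkOf F v)
  ... | no  _    = F v

  rootOf-merge : ∀ e F v → rootOf (merge e F) v ≡ redirect (rootOf F (end₂ e)) (rootOf F (end₁ e)) (rootOf F v)
  rootOf-merge e F v with rootOf F v ≟ rootOf F (end₂ e)
  ... | yes _ = refl
  ... | no  _ = refl

  merge-preserves : ∀ e F {u w} → rootOf F u ≡ rootOf F w → rootOf (merge e F) u ≡ rootOf (merge e F) w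
  merge-preserves e F {u} {w} same =
    trans (rootOf-merge e F u) (trans (cong (redirect _ _) same) (sym (rootOf-merge e F w)))

  merge-joins : ∀ e F → rootOf (merge e F) (end₁ e) ≡ rootOf (merge e F) (end₂ e)
  merge-joins e F = begin
    rootOf (merge e F) (end₁ e)  ≡⟨ rootOf-merge e F (end₁ e) ⟩
    redirect r₂ r₁ r₁            ≡⟨ redirect-new r₂ r₁ ⟩
    r₁                           ≡⟨ redirect-old r₂ r₁ ⟨
    redirect r₂ r₁ r₂            ≡⟨ rootOf-merge e F (end₂ e) ⟨
    rootOf (merge e F) (end₂ e)  ∎
    where
      open ≡-Reasoning
      r₁ = rootOf F (end₁ e)
      r₂ = rootOf F (end₂ e)

  mergeAll : List (E G) → RootedWalks → RootedWalks
  mergeAll []       F = F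
  mergeAll (e ∷ es) F = mergeAll es (merge e F)

  mergeAll-preserves : ∀ es F {u w} → rootOf F u ≡ rootOf F w → rootOf (mergeAll es F) u ≡ rootOf (mergeAll es F) w
  mergeAll-preserves []       F same = same
  mergeAll-preserves (e ∷ es) F same = mergeAll-preserves es (merge e F) (merge-preserves e F same)

  mergeAll-joins : ∀ es F {e} → e ∈ es → rootOf (mergeAll es F) (end₁ e) ≡ rootOf (mergeAll es F) (end₂ e)
  mergeAll-joins (e ∷ es) F (here refl) = mergeAll-preserves es (merge e F) (merge-joins e F)
  mergeAll-joins (_ ∷ es) F (there e∈)  = mergeAll-joins es _ e∈

rooting : (G : Graph) → Rooting G
rooting G = record
  { root       = rootOf spanning
  ; path       = walkOf spanning
  ; root-joins = root-joins
  }
  where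
    open UnionFind {G}
    open Incidence G
    open Graph G using (nE)

    spanning : RootedWalks
    spanning = mergeAll (allFin nE) (λ v → v , [])

    root-joins : ∀ e {u w} → T (joins G e u w) → rootOf spanning u ≡ rootOf spanning w
    root-joins e p with joins⇒ends e p
    ... | inj₁ (refl , refl) = mergeAll-joins (allFin nE) _ (∈-allFin e)
    ... | inj₂ (refl , refl) = sym (mergeAll-joins (allFin nE) _ (∈-allFin e))

module Cocycle {G : Graph} {𝒲 : WalkSet {G}} (exclusive : Exclusive3Walk 𝒲) where

  δ : ∀ {x y} → Walk G x y → Walk G x y → Sign
  δ W₁ W₂ = σ[ 𝒲 ] (_·_⁻¹ G W₁ W₂)

  δ-trans : ∀ {x y} (W₁ W₂ W₃ : Walk G x y) → δ W₁ W₃ ≡ δ W₁ W₂ *ˢ δ W₂ W₃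
  δ-trans W₁ W₂ W₃ = [ab]c≡pos⇒b≡ac (δ W₁ W₂) (δ W₁ W₃) (δ W₂ W₃) (exclusive W₁ W₂ W₃)

  δ-refl : ∀ {x y} (W : Walk G x y) → δ W W ≡ pos
  δ-refl W = trans (δ-trans W W W) (*ˢ-self (δ W W))

  δ-sym : ∀ {x y} (W₁ W₂ : Walk G x y) → δ W₁ W₂ ≡ δ W₂ W₁
  δ-sym W₁ W₂ = ab≡pos⇒a≡b (δ W₁ W₂) (δ W₂ W₁) (trans (sym (δ-trans W₁ W₂ W₁)) (δ-refl W₁))

  δ-flip-edge : ∀ e {z a b} (A : Walk G z a) (B : Walk G z b)
                (p : T (joins G e a b)) (q : T (joins G e b a)) →
                δ (B ⊕ edge e q) A ≡ δ (A ⊕ edge e p) B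
  δ-flip-edge e A B p q = begin
    δ (B ⊕ edge e q) A                           ≡⟨ δ-sym (B ⊕ edge e q) A ⟩
    σ[ 𝒲 ] (_ , A ⊕ rev (B ⊕ edge e q))          ≡⟨ cong (λ W → σ[ 𝒲 ] (_ , A ⊕ W)) (rev-⊕ B (edge e q)) ⟩
    σ[ 𝒲 ] (_ , A ⊕ rev (edge e q) ⊕ rev B)      ≡⟨ cong (λ W → σ[ 𝒲 ] (_ , A ⊕ W ⊕ rev B)) (rev-edge e q p) ⟩
    σ[ 𝒲 ] (_ , A ⊕ edge e p ⊕ rev B)            ≡⟨ cong (λ W → σ[ 𝒲 ] (_ , W)) (⊕-assoc A (edge e p) (rev B)) ⟨
    δ (A ⊕ edge e p) B                           ∎
    where open ≡-Reasoning

  δ-backtrack : ∀ {x y} (W : Walk G x x) (P : Walk G y x) → δ W (rev P ⊕ P) ≡ σ[ 𝒲 ] (x , W)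
  δ-backtrack {x} W P = begin
    δ W (rev P ⊕ P)                       ≡⟨ δ-trans W [] (rev P ⊕ P) ⟩
    δ W [] *ˢ δ [] (rev P ⊕ P)            ≡⟨ cong₂ _*ˢ_ (cong (λ V → σ[ 𝒲 ] (x , V)) (⊕-identityʳ W))
                                                        (trans (cong (λ V → σ[ 𝒲 ] (x , V)) (rev-⊕ (rev P) P))
                                                               (δ-refl (rev P))) ⟩
    σ[ 𝒲 ] (x , W) *ˢ pos                 ≡⟨ *ˢ-identityʳ _ ⟩
    σ[ 𝒲 ] (x , W)                        ∎
    where open ≡-Reasoning

module Sufficiency {G : Graph} {𝒲 : WalkSet {G}}
                   (rotation : ClosedUnderRotation 𝒲) (exclusive : Exclusive3Walk 𝒲) where
  open Cocycle {𝒲 = 𝒲} exclusive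
  open Incidence G
  open Rooting (rooting G)

  pathTo : ∀ v {z} → root v ≡ z → Walk G z v
  pathTo v r≡z = subst (λ r → Walk G r v) r≡z (path v)

  root-ends : ∀ e → root (end₁ e) ≡ root (end₂ e)
  root-ends e = root-joins e (joins-ends e)

  edgeSign : Signature {G}
  edgeSign e = δ (path (end₁ e) ⊕ edge e (joins-ends e)) (pathTo (end₂ e) (sym (root-ends e)))

  edgeSign-aligned : ∀ e (p : T (joins G e (end₁ e) (end₂ e))) {z}
                     (r₁≡z : root (end₁ e) ≡ z) (r₂≡z : root (end₂ e) ≡ z) →
                     δ (pathTo (end₁ e) r₁≡z ⊕ edge e p) (pathTo (end₂ e) r₂≡z) ≡ edgeSign e
  edgeSign-aligned e p refl r₂≡z =
    cong₂ (λ p′ eq → δ (path (end₁ e) ⊕ edge e p′) (pathTo (end₂ e) eq))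
          (T-irrelevant p (joins-ends e))
          (Decidable⇒UIP.≡-irrelevant _≟_ r₂≡z (sym (root-ends e)))

  edgeSign-canonical : ∀ e {u w} (p : T (joins G e u w)) {z} (ru≡z : root u ≡ z) (rw≡z : root w ≡ z) →
                       δ (pathTo u ru≡z ⊕ edge e p) (pathTo w rw≡z) ≡ edgeSign e
  edgeSign-canonical e p ru≡z rw≡z with joins⇒ends e p
  ... | inj₁ (refl , refl) = edgeSign-aligned e p ru≡z rw≡z
  ... | inj₂ (refl , refl) =
    trans (δ-flip-edge e (pathTo _ rw≡z) (pathTo _ ru≡z) (joins-ends e) p)
          (edgeSign-aligned e (joins-ends e) rw≡z ru≡z)

  δ-pathTo : ∀ {u v} (W : Walk G u v) {z} (ru≡z : root u ≡ z) (rv≡z : root v ≡ z) →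
             δ (pathTo u ru≡z ⊕ W) (pathTo v rv≡z) ≡ walkSign edgeSign W
  δ-pathTo {u} [] ru≡z rv≡z =
    trans (cong₂ δ (⊕-identityʳ (pathTo u ru≡z)) (cong (pathTo u) (Decidable⇒UIP.≡-irrelevant _≟_ rv≡z ru≡z)))
          (δ-refl (pathTo u ru≡z))
  δ-pathTo {u} {v} (step e {w} p W) ru≡z rv≡z = begin
    δ (Pu ⊕ step e p W) Pv                 ≡⟨ cong (λ A → δ A Pv) (⊕-assoc Pu (edge e p) W) ⟨
    δ ((Pu ⊕ edge e p) ⊕ W) Pv             ≡⟨ cong σ[ 𝒲 ] (·⁻¹-shift (Pu ⊕ edge e p) W Pv) ⟩
    δ (Pu ⊕ edge e p) (Pv ⊕ rev W)         ≡⟨ δ-trans (Pu ⊕ edge e p) Pw (Pv ⊕ rev W) ⟩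
    δ (Pu ⊕ edge e p) Pw *ˢ δ Pw (Pv ⊕ rev W)
      ≡⟨ cong₂ _*ˢ_ (edgeSign-canonical e p ru≡z rw≡z) (cong σ[ 𝒲 ] (sym (·⁻¹-shift Pw W Pv))) ⟩
    edgeSign e *ˢ δ (Pw ⊕ W) Pv            ≡⟨ cong (edgeSign e *ˢ_) (δ-pathTo W rw≡z rv≡z) ⟩
    edgeSign e *ˢ walkSign edgeSign W      ≡⟨ walkSign-step edgeSign e p W ⟨
    walkSign edgeSign (step e p W)         ∎
    where
      open ≡-Reasoning
      rw≡z = trans (sym (root-joins e p)) ru≡z
      Pu = pathTo u ru≡z
      Pv = pathTo v rv≡z
      Pw = pathTo w rw≡z

  σ[𝒲]≡walkSign : ∀ {x} (W : Walk G x x) → σ[ 𝒲 ] (x , W) ≡ walkSign edgeSign W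
  σ[𝒲]≡walkSign {x} W = begin
    σ[ 𝒲 ] (x , W)                     ≡⟨ δ-backtrack W P ⟨
    σ[ 𝒲 ] (x , W ⊕ rev (rev P ⊕ P))   ≡⟨ cong (λ V → σ[ 𝒲 ] (x , W ⊕ V)) (rev-rev-⊕ P P) ⟩
    σ[ 𝒲 ] (x , W ⊕ rev P ⊕ P)         ≡⟨ cong (λ V → σ[ 𝒲 ] (x , V)) (⊕-assoc W (rev P) P) ⟨
    σ[ 𝒲 ] (x , (W ⊕ rev P) ⊕ P)       ≡⟨ to (closedUnderRotation⇔ {𝒲 = 𝒲}) rotation P (W ⊕ rev P) ⟨
    σ[ 𝒲 ] (root x , P ⊕ W ⊕ rev P)    ≡⟨ cong (λ V → σ[ 𝒲 ] (root x , V)) (⊕-assoc P W (rev P)) ⟨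
    δ (P ⊕ W) P                        ≡⟨ δ-pathTo W refl refl ⟩
    walkSign edgeSign W                ∎
    where
      open ≡-Reasoning
      P = path x

  negativeWalkSet : ∃[ σ ] IsNegativeWalkSetOf σ 𝒲
  negativeWalkSet = edgeSign , from (isNegativeWalkSetOf⇔ edgeSign) σ[𝒲]≡walkSign

theorem3 : (G : Graph) (𝒲 : WalkSet {G}) →
    (∃[ σ ] IsNegativeWalkSetOf σ 𝒲) ⇔ (ClosedUnderRotation 𝒲 × Exclusive3Walk 𝒲)
theorem3 G 𝒲 = mk⇔
  (λ (σ , 𝒲-negative) → negativeWalkSet-closedUnderRotation 𝒲-negative
                       , negativeWalkSet-exclusive3Walk 𝒲-negative)
  (λ (rotation , exclusive) → Sufficiency.negativeWalkSet rotation exclusive)
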